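{- Let $X$ be a connected graph without loops and multiple edges, let $e$ be a vertex-cut, and let $\xi$ be an infinite sequence of pairwise different elements of $e\cup\Omega_{\mathrm{V}}e$. If no connected component of $e$ contains infinitely many elements of $\xi$, then $\xi$ has an accumulation point in $\theta e$ with respect to $\tau_{\mathrm{V}}X$.
   Context: For $e\subseteq VX$, $e^{*}=VX\setminus e$ and $\theta e$ is the set of vertices of $e^{*}$ adjacent to a vertex of $e$. A vertex-cut is a nonempty $e$ with $\theta e$ finite. A ray is a sequence of pairwise distinct vertices with consecutive ones adjacent; it lies in $e$ if all but finitely many of its vertices are in $e$; $e$ separates two rays if one lies in $e$ and the other in $e^{*}$. Rays are vertex-equivalent if no vertex-cut separates them; classes are vertex-ends; a vertex-end lies in $e$ if all its rays lie in $e$ (a component contains a vertex-end if the end lies in it); $\Omega_{\mathrm{V}}e$ is the set of vertex-ends lying in $e$, $\Omega_{\mathrm{V}}X=\Omega_{\mathrm{V}}VX$. $\tau_{\mathrm{V}}X$ is the topology on $VX\cup\Omega_{\mathrm{V}}X$ generated by $\{e\cup\Omega_{\mathrm{V}}e\mid e\subseteq VX,\ |\theta e|<\infty\}$. -}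

module Defs where

open import Level using (Level; 0ℓ) renaming (suc to lsuc)
open import Data.Nat using (ℕ; suc; _≤_)
open import Data.Product using (Σ; ∃; ∃-syntax; _×_; _,_)
open import Data.Sum using (_⊎_; inj₁; inj₂)
open import Data.Empty using (⊥)
open import Data.Unit using (⊤)
open import Data.List using (List; []; _∷_)
open import Data.List.Membership.Propositional using (_∈_)
open import Data.List.Relation.Unary.All using (All)
open import Relation.Nullary using (¬_)
open import Relation.Binary.PropositionalEquality using (_≡_; _≢_)

record Graph : Set₁ where
  field
    V       : Set
    _~_     : V → V → Set
    ~-sym   : ∀ {u v} → u ~ v → v ~ u
    ~-irrefl : ∀ {v} → ¬ (v ~ v)

VSet : Set → Set₁
VSet V = V → Set

module _ (X : Graph) where
  open Graph X

  data WalkIn (S : VSet V) : V → V → Set where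
    here : ∀ {v} → S v → WalkIn S v v
    step : ∀ {u w v} → S u → u ~ w → WalkIn S w v → WalkIn S u v

  everything : VSet V
  everything _ = ⊤

  Connected : Set
  Connected = ∀ u v → WalkIn everything u v

  co : VSet V → VSet V
  co e v = ¬ e v

  θ : VSet V → VSet V
  θ e v = ¬ e v × ∃[ u ] (e u × u ~ v)

  Finite : VSet V → Set
  Finite S = ∃[ xs ] (∀ v → S v → v ∈ xs)

  VertexCut : VSet V → Set
  VertexCut e = (∃[ v ] e v) × Finite (θ e)

  record Ray : Set where
    field
      at   : ℕ → V
      inj  : ∀ i j → at i ≡ at j → i ≡ j
      adj  : ∀ i → at i ~ at (suc i)
  open Ray public

  LiesIn : Ray → VSet V → Set
  LiesIn r e = ∃[ N ] (∀ n → N ≤ n → e (at r n))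

  Separates : VSet V → Ray → Ray → Set
  Separates e r s = (LiesIn r e × LiesIn s (co e)) ⊎ (LiesIn s e × LiesIn r (co e))

  -- vertex-equivalence of rays; vertex-ends are its classes,
  -- represented by rays up to this equivalence
  VEquiv : Ray → Ray → Set₁
  VEquiv r s = ∀ e → VertexCut e → ¬ Separates e r s

  EndLiesIn : Ray → VSet V → Set₁
  EndLiesIn r e = ∀ s → VEquiv r s → LiesIn s e

  -- points of VX ∪ Ω_V X (ends represented by rays)
  Point : Set
  Point = V ⊎ Ray

  _≈P_ : Point → Point → Set₁
  inj₁ v ≈P inj₁ w = Level.Lift (lsuc 0ℓ) (v ≡ w)
  inj₁ v ≈P inj₂ s = Level.Lift (lsuc 0ℓ) ⊥
  inj₂ r ≈P inj₁ w = Level.Lift (lsuc 0ℓ) ⊥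
  inj₂ r ≈P inj₂ s = VEquiv r s

  -- membership of a point in e ∪ Ω_V e
  InCl : Point → VSet V → Set₁
  InCl (inj₁ v) e = Level.Lift (lsuc 0ℓ) (e v)
  InCl (inj₂ r) e = EndLiesIn r e

  Component : VSet V → V → VSet V
  Component e u v = WalkIn e u v

  InfinitelyMany : (ℕ → Set₁) → Set₁
  InfinitelyMany P = ∀ N → ∃[ n ] (N ≤ n × P n)

  -- basic open sets of τ_V X: e ∪ Ω_V e with θ e finite
  Basic : VSet V → Set
  Basic e = Finite (θ e)

  -- Since τ_V X is generated by the
  -- basic sets, it suffices (and is necessary) to test finite intersections
  -- of basic sets containing p.
  AccumulationPoint : (ℕ → Point) → Point → Set₁
  AccumulationPoint ξ p =
    (es : List (VSet V)) → All Basic es → All (InCl p) es →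
    InfinitelyMany (λ n → All (InCl (ξ n)) es)

module Submission where

-- Suppose no vertex of the finite set θ e accumulates ξ. Then each v ∈ θ e has a basic
-- neighbourhood a missing ξ n for all large n, and since θ a is finite and each component of e
-- contains only finitely many ξ n, for large n no component of e meeting θ a contains ξ n.
-- Fix such an n and a component C of e containing ξ n. A walk leaving C reaches some v ∈ θ e;
-- a walk inside C from a neighbour of v to a vertex of C outside the neighbourhood a of v must
-- cross θ a, so C meets θ a, a contradiction. If e is all of VX, its one component contains
-- every ξ n.

open import Defs
open import Level using (Level; 0ℓ; Lift; lift; lower) renaming (suc to lsuc; _⊔_ to _⊔ˡ_)
open import Axiom.ExcludedMiddle using (ExcludedMiddle)
open import Axiom.DoubleNegationElimination using (em⇒dne)
open import Data.Nat using (ℕ; _≤_; _≤′_; ≤′-refl; ≤′-step; _⊔_)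
open import Data.Nat.Properties using (≤-refl; ≤-trans; m≤m⊔n; m≤n⊔m; ≤⇒≤′; ≤′⇒≤)
open import Data.Product using (∃-syntax; _×_; _,_; proj₁; proj₂; uncurry)
open import Data.Sum using (inj₁; inj₂; [_,_])
open import Data.Empty using (⊥-elim)
open import Data.List using (List; []; _∷_; _++_)
open import Data.List.Relation.Unary.All as All using (All; []; _∷_)
open import Data.List.Relation.Unary.All.Properties using (¬All⇒Any¬)
open import Data.List.Membership.Propositional using (_∈_)
open import Data.List.Membership.Propositional.Properties using (∈-++⁺ˡ; ∈-++⁺ʳ)
open import Function using (_∘_)
open import Relation.Nullary using (¬_; yes; no)
open import Relation.Nullary.Decidable using (map′)
open import Relation.Binary.PropositionalEquality using (_≢_)

module _ {a b : Level} {A : Set a} {B : A → Set b} (em : ExcludedMiddle (a ⊔ˡ b)) where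

  ¬∀⇒∃¬ : ¬ (∀ x → B x) → ∃[ x ] ¬ B x
  ¬∀⇒∃¬ ¬∀ = em⇒dne em λ ¬∃ → ¬∀ λ x →
    lower (em⇒dne em {Lift a (B x)} λ ¬Bx → ¬∃ (x , ¬Bx ∘ lift))

module _ {a p q : Level} {A : Set a} {P : A → Set p} {Q : A → Set q}
         (em : ExcludedMiddle (a ⊔ˡ p ⊔ˡ q)) where

  ¬∀→⇒∃×¬ : ¬ (∀ x → P x → Q x) → ∃[ x ] (P x × ¬ Q x)
  ¬∀→⇒∃×¬ ¬∀ with ¬∀⇒∃¬ em ¬∀
  ... | x , ¬[P→Q] with ¬∀⇒∃¬ {A = Lift (a ⊔ˡ q) (P x)} em (¬[P→Q] ∘ (_∘ lift))
  ...   | lift px , ¬Qx = x , px , ¬Qx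

Eventually : ∀ {ℓ} → (ℕ → Set ℓ) → Set ℓ
Eventually P = ∃[ N ] (∀ n → N ≤ n → P n)

module _ {p q : Level} {P : ℕ → Set p} {Q : ℕ → Set q} where

  Eventually-map : (∀ {n} → P n → Q n) → Eventually P → Eventually Q
  Eventually-map f (N , p) = N , λ n N≤n → f (p n N≤n)

  Eventually-zip : Eventually P → Eventually Q → Eventually (λ n → P n × Q n)
  Eventually-zip (M , p) (N , q) =
    M ⊔ N , λ n le → p n (≤-trans (m≤m⊔n M N) le) , q n (≤-trans (m≤n⊔m M N) le)

Eventually-All : ∀ {a p} {A : Set a} {P : A → ℕ → Set p} {xs : List A} →
  All (λ x → Eventually (P x)) xs → Eventually (λ n → All (λ x → P x n) xs)
Eventually-All []       = 0 , λ _ _ → []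
Eventually-All (p ∷ ps) = Eventually-map (uncurry _∷_) (Eventually-zip p (Eventually-All ps))

module Walks (X : Graph) where
  open Graph X

  walk-start : ∀ {S u v} → WalkIn X S u v → S u
  walk-start (here s)     = s
  walk-start (step s _ _) = s

  walk-end : ∀ {S u v} → WalkIn X S u v → S v
  walk-end (here s)     = s
  walk-end (step _ _ w) = walk-end w

  infixr 5 _++ʷ_
  _++ʷ_ : ∀ {S u v w} → WalkIn X S u v → WalkIn X S v w → WalkIn X S u w
  here _     ++ʷ q = q
  step s a p ++ʷ q = step s a (p ++ʷ q)

  reverse : ∀ {S u v} → WalkIn X S u v → WalkIn X S v u
  reverse (here s)     = here s
  reverse (step s a p) = reverse p ++ʷ step (walk-start p) (~-sym a) (here s)

  walk-mono : ∀ {S T u v} → (∀ x → S x → T x) → WalkIn X S u v → WalkIn X T u v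
  walk-mono S⊆T (here s)     = here (S⊆T _ s)
  walk-mono S⊆T (step s a p) = step (S⊆T _ s) a (walk-mono S⊆T p)

  tail-walk : ∀ {S} (r : Ray X) {K} → (∀ m → K ≤ m → S (at r m)) →
    ∀ m → K ≤ m → WalkIn X S (at r K) (at r m)
  tail-walk {S} r {K} inS m K≤m = go m (≤⇒≤′ K≤m)
    where
    go : ∀ m → K ≤′ m → WalkIn X S (at r K) (at r m)
    go _ ≤′-refl            = here (inS K ≤-refl)
    go _ (≤′-step {m} K≤′m) =
      go m K≤′m ++ʷ step (walk-end (go m K≤′m)) (adj r m) (here (inS _ (≤′⇒≤ (≤′-step K≤′m))))

  LiesIn⇒¬LiesIn-co : ∀ {S} r → LiesIn X r S → ¬ LiesIn X r (co X S)
  LiesIn⇒¬LiesIn-co r (M , inS) (N , outS) =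
    outS (M ⊔ N) (m≤n⊔m M N) (inS (M ⊔ N) (m≤m⊔n M N))

  VEquiv-refl : ∀ r → VEquiv X r r
  VEquiv-refl r S _ = [ uncurry (LiesIn⇒¬LiesIn-co {S} r) , uncurry (LiesIn⇒¬LiesIn-co {S} r) ]

  InCl-mono : ∀ {S T} p → (∀ x → S x → T x) → InCl X p S → InCl X p T
  InCl-mono (inj₁ v) S⊆T (lift Sv) = lift (S⊆T v Sv)
  InCl-mono (inj₂ r) S⊆T rS s r≈s with rS s r≈s
  ... | N , inS = N , λ n N≤n → S⊆T _ (inS n N≤n)

  InCl-everything : ∀ {S} p → (∀ x → S x) → InCl X p S
  InCl-everything (inj₁ v) all = lift (all v)
  InCl-everything (inj₂ r) all = λ s _ → 0 , λ n _ → all (at s n)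

  θ-Component⊆θ : ∀ {e c v} → θ X (Component X e c) v → θ X e v
  θ-Component⊆θ (v∉C , u , c→u , u~v) =
    (λ ev → v∉C (c→u ++ʷ step (walk-end c→u) u~v (here ev))) , u , walk-end c→u , u~v

  Component-vertexCut : ∀ {e c} → Finite X (θ X e) → e c → VertexCut X (Component X e c)
  Component-vertexCut (xs , θe⊆xs) ec = (_ , here ec) , xs , λ v θv → θe⊆xs v (θ-Component⊆θ θv)

  finite-union : ∀ {a} {A : Set a} (S : A → VSet V) {as : List A} →
    All (λ x → Finite X (S x)) as → ∃[ vs ] All (λ x → ∀ v → S x v → v ∈ vs) as
  finite-union S []                 = [] , []
  finite-union S ((xs , fin) ∷ fins) with finite-union S fins
  ... | vs , subs =
    xs ++ vs , (λ v Sv → ∈-++⁺ˡ (fin v Sv)) ∷ All.map (λ sub v Sv → ∈-++⁺ʳ xs (sub v Sv)) subs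

module Classical (em : ExcludedMiddle (lsuc 0ℓ)) where

  em₀ : ExcludedMiddle 0ℓ
  em₀ = map′ lower lift em

  ¬InfinitelyMany⇒Eventually¬ : ∀ X {P : ℕ → Set₁} → ¬ InfinitelyMany X P → Eventually (¬_ ∘ P)
  ¬InfinitelyMany⇒Eventually¬ X ¬inf with ¬∀⇒∃¬ em ¬inf
  ... | N , ¬∃ = N , λ n N≤n Pn → ¬∃ (n , N≤n , Pn)

  Eventually-→ : {P : Set} {Q : ℕ → Set₁} → (P → Eventually Q) → Eventually (λ n → P → Q n)
  Eventually-→ {P} f with em₀ {P}
  ... | yes p  = Eventually-map (λ q _ → q) (f p)
  ... | no ¬p = 0 , λ _ _ p → ⊥-elim (¬p p)

  module Crossing (X : Graph) where
    open Graph X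
    open Walks X

    walk-leaves : ∀ {S e x y} → e x → ¬ e y → WalkIn X S x y →
      ∃[ w ] ∃[ v ] (WalkIn X e x w × w ~ v × ¬ e v)
    walk-leaves ex ¬ey (here _) = ⊥-elim (¬ey ex)
    walk-leaves {e = e} ex ¬ey (step {w = x′} _ x~x′ p) with em₀ {e x′}
    ... | no ¬ex′ = _ , x′ , here ex , x~x′ , ¬ex′
    ... | yes ex′ with walk-leaves ex′ ¬ey p
    ...   | w , v , x′→w , w~v , ¬ev = w , v , step ex x~x′ x′→w , w~v , ¬ev

    θ-on-walk : ∀ {S a v w x} → a v → v ~ w → WalkIn X S w x → ¬ a x →
      ∃[ q ] (θ X a q × WalkIn X S q x)
    θ-on-walk av v~w (here s) ¬ax = _ , (¬ax , _ , av , v~w) , here s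
    θ-on-walk {a = a} {w = w} av v~w (step s w~w′ p) ¬ax with em₀ {a w}
    ... | no ¬aw = w , (¬aw , _ , av , v~w) , step s w~w′ p
    ... | yes aw = θ-on-walk aw w~w′ p ¬ax

    module FiniteBoundary {e : VSet V} (θe-finite : Finite X (θ X e)) where

      end-lies-in-component : ∀ r {K} → EndLiesIn X r e → (∀ m → K ≤ m → e (at r m)) →
        EndLiesIn X r (Component X e (at r K))
      end-lies-in-component r {K} r⊆e rK s r≈s with r⊆e s r≈s
      ... | K′ , sK′ with em₀ {WalkIn X e (at r K) (at s K′)}
      ... | yes r→s = K′ , λ m K′≤m → r→s ++ʷ tail-walk s sK′ m K′≤m
      ... | no ¬r→s =
        ⊥-elim (r≈s (Component X e (at r K)) (Component-vertexCut θe-finite (rK K ≤-refl))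
          (inj₁ ((K , tail-walk r rK) ,
                 (K′ , λ m K′≤m r→sm → ¬r→s (r→sm ++ʷ reverse (tail-walk s sK′ m K′≤m))))))

      in-component : ∀ p → InCl X p e → ∃[ c ] (e c × InCl X p (Component X e c) ×
        (∀ a → ¬ InCl X p a → ∃[ x ] (WalkIn X e c x × ¬ a x)))
      in-component (inj₁ x) (lift ex) = x , ex , lift (here ex) , λ a ¬ax → x , here ex , ¬ax ∘ lift
      in-component (inj₂ r) r⊆e with r⊆e r (VEquiv-refl r)
      ... | K , rK = at r K , rK K ≤-refl , end-lies-in-component r r⊆e rK , misses
        where
        misses : ∀ a → ¬ EndLiesIn X r a → ∃[ x ] (WalkIn X e (at r K) x × ¬ a x)
        misses a ¬r⊆a with ¬∀→⇒∃×¬ em ¬r⊆a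
        ... | s , r≈s , ¬s⊆a with end-lies-in-component r r⊆e rK s r≈s
        ... | K′ , sC with ¬∀→⇒∃×¬ em₀ (¬s⊆a ∘ (K′ ,_))
        ... | j , K′≤j , ¬asj = at s j , sC j K′≤j , ¬asj

      Guarded : V → Point X → Set₁
      Guarded v p =
        ∃[ a ] (a v × ¬ InCl X p a × (∀ q → θ X a q → e q → ¬ InCl X p (Component X e q)))

      ¬guarded-on-θ : Connected X → ∀ {y} → ¬ e y → ∀ p → InCl X p e →
        ¬ (∀ v → θ X e v → Guarded v p)
      ¬guarded-on-θ conn ¬ey p p∈e guarded with in-component p p∈e
      ... | c , ec , p∈C , misses with walk-leaves ec ¬ey (conn c _)
      ... | w , v , c→w , w~v , ¬ev with guarded v (¬ev , w , walk-end c→w , w~v)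
      ... | a , av , p∉a , shielded with misses a p∉a
      ... | x , c→x , ¬ax with θ-on-walk av (~-sym w~v) (reverse c→w ++ʷ c→x) ¬ax
      ... | q , θaq , q→x =
        shielded q θaq (walk-start q→x) (InCl-mono p (λ u c→u → q→x ++ʷ reverse c→x ++ʷ c→u) p∈C)

  module Accumulation (X : Graph) (conn : Connected X) {e : VSet (Graph.V X)}
    (θe-finite : Finite X (θ X e)) (ξ : ℕ → Point X) (ξ⊆e : ∀ n → InCl X (ξ n) e)
    (sparse : ∀ u → e u → ¬ InfinitelyMany X (λ n → InCl X (ξ n) (Component X e u))) where
    open Graph X
    open Walks X
    open Crossing X
    open FiniteBoundary θe-finite

    ¬accumulation⇒eventually-guarded : ∀ v → ¬ AccumulationPoint X ξ (inj₁ v) →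
      Eventually (Guarded v ∘ ξ)
    ¬accumulation⇒eventually-guarded v ¬acc with ¬∀→⇒∃×¬ em ¬acc
    ... | es , basic , ¬[v∈es→inf] with ¬∀⇒∃¬ em ¬[v∈es→inf]
    ... | v∈es , ¬inf with finite-union (θ X) basic
    ... | Bs , θ⊆Bs =
      Eventually-map guard
        (Eventually-zip (¬InfinitelyMany⇒Eventually¬ X ¬inf) (Eventually-All (All.tabulate outside)))
      where
      outside : ∀ {b} → b ∈ Bs → Eventually (λ n → e b → ¬ InCl X (ξ n) (Component X e b))
      outside {b} _ = Eventually-→ (¬InfinitelyMany⇒Eventually¬ X ∘ sparse b)

      guard : ∀ {n} → ¬ All (InCl X (ξ n)) es × All (λ b → e b → ¬ InCl X (ξ n) (Component X e b)) Bs →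
        Guarded v (ξ n)
      guard (¬all , outsideBs)
        with All.lookupAny (All.zip (v∈es , θ⊆Bs)) (¬All⇒Any¬ (λ _ → em) es ¬all)
      ... | (lift av , θa⊆Bs) , ξ∉a =
        _ , av , ξ∉a , λ q θaq eq → All.lookup outsideBs (θa⊆Bs q θaq) eq

    eventually-guarded-on-θ : (∀ v → θ X e v → ¬ AccumulationPoint X ξ (inj₁ v)) →
      Eventually (λ n → ∀ v → θ X e v → Guarded v (ξ n))
    eventually-guarded-on-θ nacc =
      Eventually-map (λ guarded v θv → All.lookup guarded (θe⊆vs v θv) θv)
        (Eventually-All (All.tabulate λ {v} _ →
          Eventually-→ λ θv → ¬accumulation⇒eventually-guarded v (nacc v θv)))
      where
      θe⊆vs : ∀ v → θ X e v → v ∈ proj₁ θe-finite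
      θe⊆vs = proj₂ θe-finite

    ¬accumulation⇒e-everything : (∀ v → θ X e v → ¬ AccumulationPoint X ξ (inj₁ v)) → ∀ y → e y
    ¬accumulation⇒e-everything nacc y with eventually-guarded-on-θ nacc
    ... | N , guarded =
      em⇒dne em₀ λ ¬ey → ¬guarded-on-θ conn ¬ey (ξ N) (ξ⊆e N) (guarded N ≤-refl)

    e-everything⇒InfinitelyMany : (∀ y → e y) →
      ∀ u → InfinitelyMany X (λ n → InCl X (ξ n) (Component X e u))
    e-everything⇒InfinitelyMany e-everything u M =
      M , ≤-refl , InCl-everything (ξ M) (λ x → walk-mono (λ z _ → e-everything z) (conn u x))

    accumulation-on-θ : ∀ {u} → e u → ∃[ v ] (θ X e v × AccumulationPoint X ξ (inj₁ v))
    accumulation-on-θ {u} eu = em⇒dne em λ none →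
      sparse u eu (e-everything⇒InfinitelyMany
        (¬accumulation⇒e-everything λ v θv acc → none (v , θv , acc)) u)

lemma4 : ExcludedMiddle (lsuc 0ℓ) →
    (X : Graph) → Connected X →
    (e : VSet (Graph.V X)) → VertexCut X e →
    (ξ : ℕ → Point X) →
    (∀ i j → i ≢ j → ¬ (_≈P_ X (ξ i) (ξ j))) →
    (∀ n → InCl X (ξ n) e) →
    (∀ u → e u → ¬ InfinitelyMany X (λ n → InCl X (ξ n) (Component X e u))) →
    ∃[ v ] (θ X e v × AccumulationPoint X ξ (inj₁ v))
lemma4 em X conn e ((u , eu) , θe-finite) ξ _ ξ⊆e sparse =
  Classical.Accumulation.accumulation-on-θ em X conn θe-finite ξ ξ⊆e sparse eu
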